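{- For every $n$ and every decomposition $[\mathsf{K}^c_n,P]$ of the complete convex geometric graph $\mathsf{K}^c_n$ such that each member of $P$ is a triangle, \[\chi'([\mathsf{K}^c_n,P])\geq \frac{n^{2}}{119}-O(n).\]
   Context: $\mathsf{K}^c_n$ denotes the complete geometric graph whose $n$ vertices are points in convex position (the vertices of a convex polygon, e.g. a regular $n$-gon) and whose edges are all $\binom n2$ straight-line segments between them. A decomposition $[G,P]$ of a graph $G$ is a set $P$ of non-empty induced subgraphs of $G$ such that every edge of $G$ belongs to exactly one member of $P$; a triangle is a complete subgraph on $3$ vertices. Two geometric graphs have nonempty intersection if they share a vertex or some edge of one crosses some edge of the other. A $k$-$P$-coloring assigns to each edge one of $k$ colors so that all edges of each member of $P$ get the same color and any two members of $P$ with nonempty intersection get different colors; the chromatic index $\chi'([\mathsf{K}^c_n,P])$ is the least such $k$. -}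

module Defs where

open import Data.Nat using (ℕ)
open import Data.Fin using (Fin; _<_)
open import Data.Product using (Σ; _×_; _,_)
open import Data.Sum using (_⊎_)
open import Relation.Binary.PropositionalEquality using (_≡_; _≢_)

-- Vertices of K^c_n are Fin n, listed in cyclic (convex) order.
-- An edge (chord) is an ordered pair (i , j) with i < j.

-- Chords (p,q), (r,s) with p < q, r < s cross iff their endpoints
-- strictly interleave along the convex polygon.
Crosses : ∀ {n} → Fin n → Fin n → Fin n → Fin n → Set
Crosses p q r s = (p < r × r < q × q < s) ⊎ (r < p × p < s × s < q)

record Triangle (n : ℕ) : Set where
  constructor tri
  field
    a b c : Fin n
    a<b : a < b
    b<c : b < c
open Triangle public

EdgeOf : ∀ {n} → Fin n → Fin n → Triangle n → Set
EdgeOf i j t = (i ≡ a t × j ≡ b t) ⊎ (i ≡ a t × j ≡ c t) ⊎ (i ≡ b t × j ≡ c t)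

VertexOf : ∀ {n} → Fin n → Triangle n → Set
VertexOf v t = v ≡ a t ⊎ v ≡ b t ⊎ v ≡ c t

Intersect : ∀ {n} → Triangle n → Triangle n → Set
Intersect t t' =
  Σ _ (λ v → VertexOf v t × VertexOf v t')
  ⊎ Σ _ (λ p → Σ _ (λ q → Σ _ (λ r → Σ _ (λ s →
      EdgeOf p q t × EdgeOf r s t' × Crosses p q r s))))

IsTriangleDecomposition : ∀ {n m} → (Fin m → Triangle n) → Set
IsTriangleDecomposition {n} {m} T =
  ∀ (i j : Fin n) → i < j →
    Σ (Fin m) (λ r → EdgeOf i j (T r) × (∀ r' → EdgeOf i j (T r') → r' ≡ r))

-- A k-P-coloring: since all edges of a member get the same colour, it is
-- given by a colour for each member; intersecting distinct members get
-- different colours.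
IsPColoring : ∀ {n m k} → (Fin m → Triangle n) → (Fin m → Fin k) → Set
IsPColoring {m = m} T col =
  ∀ (r r' : Fin m) → r ≢ r' → Intersect (T r) (T r') → col r ≢ col r'

-- Fix the gap G = ⌊n / 11⌋ and call a triangle fat if each of the three arcs of the
-- polygon cut off by its sides has more than G edges. A triangle that is not fat has a
-- short arc (at most G edges), and since every chord lies in exactly one triangle the
-- short arc determines it; hence there are at most n G thin triangles. Triangles of one
-- colour are pairwise disjoint; splitting such a family at its leftmost member, the
-- others lie in its three arcs, and induction shows that a disjoint family of fat
-- triangles satisfies |S| (G + 3) + 2G ≤ n. So each colour has at most
-- (n - 2G) / (G + 3) fat triangles, and counting ordered pairs of vertices gives
-- n² ≤ n + 6 |P| ≤ n + 6 n G + 6 k (n - 2G) / (G + 3), which rearranges to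
-- n² ≤ 119 (k + n).
module Submission where

open import Defs
open import Data.Nat using (ℕ; zero; suc; _+_; _*_; _∸_; _≤_; _<_; z≤n; s≤s; s≤s⁻¹; _≟_; _<?_; _≤?_)
open import Data.Nat.Properties
open import Data.Nat.DivMod using (_/_; m≡m%n+[m/n]*n; m%n<n; m/n*n≤m)
open import Data.Nat.Induction using (<-wellFounded)
open import Data.Nat.Tactic.RingSolver using (solve-∀)
open import Data.Fin using (Fin; toℕ)
import Data.Fin.Properties as Fin
open import Data.Product using (Σ; _×_; _,_; proj₁; proj₂; swap)
open import Data.Sum using (_⊎_; inj₁; inj₂; [_,_]′)
open import Function using (_∘_)
open import Relation.Nullary using (¬_; Dec; yes; no; contradiction)
open import Relation.Nullary.Decidable using (_×-dec_; toSum)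
open import Relation.Unary using (Decidable; _∪_)
open import Relation.Unary.Properties using (_∪?_; ∁?)
open import Relation.Binary using (tri<; tri≈; tri>)
open import Relation.Binary.PropositionalEquality using (_≡_; _≢_; refl; sym; trans; cong; cong₂; subst)
open import Induction.WellFounded using (Acc; acc)
open import Data.List using (List; []; _∷_; length; map; filter; upTo; allFin; cartesianProduct; _++_)
open import Data.List.Properties using (length-map; length-++; length-upTo; length-tabulate; filter-all; filter-notAll)
open import Data.List.Membership.Propositional using (_∈_; _─_; lose)
open import Data.List.Membership.Propositional.Properties
  using (∈-map⁺; ∈-map⁻; ∈-++⁺ˡ; ∈-++⁺ʳ; ∈-filter⁻; ∈-cartesianProduct⁺; ∈-upTo⁺; ∈-allFin)
open import Data.List.Relation.Unary.Any using (here; there)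
open import Data.List.Relation.Unary.All as All using (All; []; _∷_)
import Data.List.Relation.Unary.All.Properties as All
open import Data.List.Relation.Unary.AllPairs as AllPairs using (AllPairs; []; _∷_)
import Data.List.Relation.Unary.AllPairs.Properties as AllPairs
open import Data.List.Relation.Unary.Unique.Propositional using (Unique)
import Data.List.Relation.Unary.Unique.Propositional.Properties as Unique
open import Data.List.Relation.Binary.Subset.Propositional using (_⊆_)
import Data.List.Relation.Binary.Sublist.Propositional.Properties as Sublist
open import Data.List.Relation.Binary.Sublist.Heterogeneous.Properties using (length-mono-≤)
open import Data.List.Extrema.Nat using (argmin; argmin-sel; f[argmin]≤f[⊤]; f[argmin]≤f[xs])

open ≤-Reasoning

-- Counting with lists

length-allFin : ∀ n → length (allFin n) ≡ n
length-allFin n = length-tabulate (λ i → i)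

length-cartesianProduct : ∀ {A B : Set} (xs : List A) (ys : List B) →
  length (cartesianProduct xs ys) ≡ length xs * length ys
length-cartesianProduct []       ys = refl
length-cartesianProduct (x ∷ xs) ys = begin-equality
  length (map (x ,_) ys ++ cartesianProduct xs ys)
    ≡⟨ length-++ (map (x ,_) ys) ⟩
  length (map (x ,_) ys) + length (cartesianProduct xs ys)
    ≡⟨ cong₂ _+_ (length-map (x ,_) ys) (length-cartesianProduct xs ys) ⟩
  length ys + length xs * length ys ∎

module _ {A : Set} where

  length-─ : ∀ {x : A} {ys} (x∈ys : x ∈ ys) → length ys ≡ suc (length (ys ─ x∈ys))
  length-─ (here _)     = refl
  length-─ (there x∈ys) = cong suc (length-─ x∈ys)

  ∈-─ : ∀ {x y : A} {ys} (x∈ys : x ∈ ys) → y ∈ ys → x ≢ y → y ∈ ys ─ x∈ys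
  ∈-─ (here x≡z)   (here y≡z)   x≢y = contradiction (trans x≡z (sym y≡z)) x≢y
  ∈-─ (here _)     (there y∈ys) _   = y∈ys
  ∈-─ (there _)    (here y≡z)   _   = here y≡z
  ∈-─ (there x∈ys) (there y∈ys) x≢y = there (∈-─ x∈ys y∈ys x≢y)

  Unique-⊆⇒length≤ : ∀ {xs ys : List A} → Unique xs → xs ⊆ ys → length xs ≤ length ys
  Unique-⊆⇒length≤ []                       _     = z≤n
  Unique-⊆⇒length≤ {x ∷ xs} {ys} (x∉xs ∷ xs!) xs⊆ys = begin
    suc (length xs)          ≤⟨ s≤s (Unique-⊆⇒length≤ xs! xs⊆ys─x) ⟩
    suc (length (ys ─ x∈ys)) ≡⟨ length-─ x∈ys ⟨
    length ys                ∎
    where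
    x∈ys : x ∈ ys
    x∈ys = xs⊆ys (here refl)
    xs⊆ys─x : xs ⊆ ys ─ x∈ys
    xs⊆ys─x y∈xs = ∈-─ x∈ys (xs⊆ys (there y∈xs)) (All.lookup x∉xs y∈xs)

  AllPairs-lookup : ∀ {R : A → A → Set} {xs x y} → (∀ {x y} → R x y → R y x) →
    AllPairs R xs → x ∈ xs → y ∈ xs → x ≡ y ⊎ R x y
  AllPairs-lookup R-sym (_   ∷ _)   (here refl) (here refl) = inj₁ refl
  AllPairs-lookup R-sym (Rx  ∷ _)   (here refl) (there y∈) = inj₂ (All.lookup Rx y∈)
  AllPairs-lookup R-sym (Rx  ∷ _)   (there x∈) (here refl) = inj₂ (R-sym (All.lookup Rx x∈))
  AllPairs-lookup R-sym (_   ∷ Rxs) (there x∈) (there y∈) = AllPairs-lookup R-sym Rxs x∈ y∈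

  AllPairs-fibre : ∀ {B : Set} {R : A → A → Set} (f : A → B) {y xs} →
    AllPairs (λ x x′ → f x ≡ f x′ → R x x′) xs → All (λ x → f x ≡ y) xs → AllPairs R xs
  AllPairs-fibre f []           []         = []
  AllPairs-fibre f (Rx ∷ Rxs) (fx≡y ∷ fxs≡y) =
    All.zipWith (λ (R′ , fx′≡y) → R′ (trans fx≡y (sym fx′≡y))) (Rx , fxs≡y) ∷ AllPairs-fibre f Rxs fxs≡y

module _ {A : Set} {P Q : A → Set} (P? : Decidable P) (Q? : Decidable Q) where

  length-filter-∪ : ∀ xs → length (filter (P? ∪? Q?) xs) ≤ length (filter P? xs) + length (filter Q? xs)
  length-filter-∪ []       = z≤n
  length-filter-∪ (x ∷ xs) with ih ← length-filter-∪ xs | P? x | Q? x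
  ... | yes _ | yes _ = s≤s (≤-trans ih (+-monoʳ-≤ _ (n≤1+n _)))
  ... | yes _ | no  _ = s≤s ih
  ... | no  _ | yes _ = ≤-trans (s≤s ih) (≤-reflexive (sym (+-suc _ _)))
  ... | no  _ | no  _ = ih

  length-≤-cover : ∀ {xs} → All (P ∪ Q) xs → length xs ≤ length (filter P? xs) + length (filter Q? xs)
  length-≤-cover {xs} P∪Q = subst (_≤ length (filter P? xs) + length (filter Q? xs))
    (cong length (filter-all (P? ∪? Q?) P∪Q)) (length-filter-∪ xs)

length-≤-filter+∁ : ∀ {A : Set} {P : A → Set} (P? : Decidable P) xs →
  length xs ≤ length (filter P? xs) + length (filter (∁? P?) xs)
length-≤-filter+∁ P? xs = length-≤-cover P? (∁? P?) {xs} (All.tabulate (λ {x} _ → toSum (P? x)))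

length*≤-by-colour : ∀ {A : Set} (colour : A → ℕ) (w B k : ℕ) (xs : List A) →
  All (λ x → colour x < k) xs →
  (∀ c → c < k → length (filter (λ x → colour x ≟ c) xs) * w ≤ B) →
  length xs * w ≤ k * B
length*≤-by-colour colour w B zero    []       _          _      = z≤n
length*≤-by-colour colour w B zero    (x ∷ xs) (() ∷ _)   _
length*≤-by-colour {A} colour w B (suc k) xs colour<k+1 class≤ = begin
  length xs * w
    ≤⟨ *-monoˡ-≤ w (length-≤-filter+∁ top? xs) ⟩
  (length (filter top? xs) + length others) * w
    ≡⟨ *-distribʳ-+ w (length (filter top? xs)) (length others) ⟩
  length (filter top? xs) * w + length others * w
    ≤⟨ +-mono-≤ (class≤ k ≤-refl) (length*≤-by-colour colour w B k others colour<k class≤′) ⟩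
  B + k * B ∎
  where
  top? : Decidable (λ x → colour x ≡ k)
  top? x = colour x ≟ k
  others : List A
  others = filter (∁? top?) xs
  colour<k : All (λ x → colour x < k) others
  colour<k = All.tabulate λ x∈ →
    let x∈xs , x≢k = ∈-filter⁻ (∁? top?) x∈ in ≤∧≢⇒< (s≤s⁻¹ (All.lookup colour<k+1 x∈xs)) x≢k
  class≤′ : ∀ c → c < k → length (filter (λ x → colour x ≟ c) others) * w ≤ B
  class≤′ c c<k = ≤-trans
    (*-monoˡ-≤ w (length-mono-≤ (Sublist.filter⁺ c? c? (λ { refl Pc → Pc }) (Sublist.filter-⊆ (∁? top?) xs))))
    (class≤ c (m≤n⇒m≤1+n c<k))
    where
    c? : Decidable (λ x → colour x ≡ c)
    c? x = colour x ≟ c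

-- Triangles in convex position

data Side : Set where
  ab bc ca : Side

Long : ℕ → ℕ × ℕ → Set
Long G arc = proj₁ arc + G < proj₂ arc

long? : ∀ G arc → Dec (Long G arc)
long? G arc = proj₁ arc + G <? proj₂ arc

shortArcs : ℕ → ℕ → List (ℕ × ℕ)
shortArcs n G = map (λ (x , d) → x , x + suc d) (cartesianProduct (upTo n) (upTo G))

length-shortArcs : ∀ n G → length (shortArcs n G) ≡ n * G
length-shortArcs n G = begin-equality
  length (shortArcs n G)                              ≡⟨ length-map _ (cartesianProduct (upTo n) (upTo G)) ⟩
  length (cartesianProduct (upTo n) (upTo G))         ≡⟨ length-cartesianProduct (upTo n) (upTo G) ⟩
  length (upTo n) * length (upTo G)                   ≡⟨ cong₂ _*_ (length-upTo n) (length-upTo G) ⟩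
  n * G                                               ∎

∈-shortArcs : ∀ {n G} arc → proj₁ arc < n → proj₁ arc < proj₂ arc → ¬ Long G arc → arc ∈ shortArcs n G
∈-shortArcs {n} {G} (x , y) x<n x<y short =
  subst (_∈ shortArcs n G) (cong (x ,_) x+[1+d]≡y)
    (∈-map⁺ _ (∈-cartesianProduct⁺ (∈-upTo⁺ x<n) (∈-upTo⁺ d<G)))
  where
  d : ℕ
  d = y ∸ suc x
  x+[1+d]≡y : x + suc d ≡ y
  x+[1+d]≡y = trans (+-suc x d) (m+[n∸m]≡n x<y)
  d<G : d < G
  d<G = +-cancelˡ-≤ x _ _ (subst (_≤ x + G) (sym x+[1+d]≡y) (≮⇒≥ short))

gaps-add-up : ∀ {G a b c h s₁ s₂ s₃} →
  suc a + s₁ * (G + 3) + G ≤ b → suc b + s₂ * (G + 3) + G ≤ c → suc c + s₃ * (G + 3) + G ≤ h →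
  a + (suc (s₁ + (s₂ + s₃)) * (G + 3) + 2 * G) ≤ h
gaps-add-up {G} {a} {b} {c} {h} {s₁} {s₂} {s₃} a→b b→c c→h = begin
  a + (suc (s₁ + (s₂ + s₃)) * K + 2 * G)
    ≡⟨ regroup a s₁ s₂ s₃ G ⟩
  suc (suc (suc a + s₁ * K + G) + s₂ * K + G) + s₃ * K + G
    ≤⟨ +-monoˡ-≤ G (+-monoˡ-≤ (s₃ * K) (s≤s (+-monoˡ-≤ G (+-monoˡ-≤ (s₂ * K) (s≤s a→b))))) ⟩
  suc (suc b + s₂ * K + G) + s₃ * K + G
    ≤⟨ +-monoˡ-≤ G (+-monoˡ-≤ (s₃ * K) (s≤s b→c)) ⟩
  suc c + s₃ * K + G
    ≤⟨ c→h ⟩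
  h ∎
  where
  K : ℕ
  K = G + 3
  regroup : ∀ a s₁ s₂ s₃ G → a + (suc (s₁ + (s₂ + s₃)) * (G + 3) + 2 * G)
    ≡ suc (suc (suc a + s₁ * (G + 3) + G) + s₂ * (G + 3) + G) + s₃ * (G + 3) + G
  regroup = solve-∀

module _ {n : ℕ} where

  Intersect-sym : ∀ {t t′ : Triangle n} → Intersect t t′ → Intersect t′ t
  Intersect-sym (inj₁ (v , v∈t , v∈t′)) = inj₁ (v , v∈t′ , v∈t)
  Intersect-sym (inj₂ (p , q , r , s , pq∈t , rs∈t′ , cross)) =
    inj₂ (r , s , p , q , rs∈t′ , pq∈t , [ inj₂ , inj₁ ]′ cross)

  -- A record rather than ¬ Intersect t t′, so that t and t′ can be inferred from it.
  record Disjoint (t t′ : Triangle n) : Set where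
    constructor disjoint
    field apart : ¬ Intersect t t′

  Disjoint-sym : ∀ {t t′} → Disjoint t t′ → Disjoint t′ t
  Disjoint-sym {t} {t′} (disjoint t∥t′) = disjoint (t∥t′ ∘ Intersect-sym {t′} {t})

  -- The arc from one vertex of t forward to the next; the arc through position 0 is
  -- unrolled, so that its length is always the difference of its end points.
  arc : Triangle n → Side → ℕ × ℕ
  arc t ab = toℕ (a t) , toℕ (b t)
  arc t bc = toℕ (b t) , toℕ (c t)
  arc t ca = toℕ (c t) , n + toℕ (a t)

  side : Triangle n → Side → Fin n × Fin n
  side t ab = a t , b t
  side t bc = b t , c t
  side t ca = a t , c t

  side-edgeOf : ∀ t s → EdgeOf (proj₁ (side t s)) (proj₂ (side t s)) t
  side-edgeOf t ab = inj₁ (refl , refl)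
  side-edgeOf t bc = inj₂ (inj₂ (refl , refl))
  side-edgeOf t ca = inj₂ (inj₁ (refl , refl))

  side-< : ∀ t s → toℕ (proj₁ (side t s)) < toℕ (proj₂ (side t s))
  side-< t ab = a<b t
  side-< t bc = b<c t
  side-< t ca = <-trans (a<b t) (b<c t)

  edgeOf⇒side : ∀ {i j t} → EdgeOf i j t → Σ Side λ s → side t s ≡ (i , j)
  edgeOf⇒side (inj₁ (refl , refl))        = ab , refl
  edgeOf⇒side (inj₂ (inj₁ (refl , refl))) = ca , refl
  edgeOf⇒side (inj₂ (inj₂ (refl , refl))) = bc , refl

  arc-start<n : ∀ t s → proj₁ (arc t s) < n
  arc-start<n t ab = Fin.toℕ<n (a t)
  arc-start<n t bc = Fin.toℕ<n (b t)
  arc-start<n t ca = Fin.toℕ<n (c t)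

  arc-start<end : ∀ t s → proj₁ (arc t s) < proj₂ (arc t s)
  arc-start<end t ab = a<b t
  arc-start<end t bc = b<c t
  arc-start<end t ca = <-≤-trans (Fin.toℕ<n (c t)) (m≤m+n n _)

  toℕ-pair-injective : ∀ {i j i′ j′ : Fin n} →
    (toℕ i , toℕ j) ≡ (toℕ i′ , toℕ j′) → (i , j) ≡ (i′ , j′)
  toℕ-pair-injective eq = cong₂ _,_ (Fin.toℕ-injective (cong proj₁ eq)) (Fin.toℕ-injective (cong proj₂ eq))

  unrolled-≢ : ∀ (i : Fin n) {x} → toℕ i ≢ n + x
  unrolled-≢ i {x} eq = <⇒≱ (Fin.toℕ<n i) (subst (n ≤_) (sym eq) (m≤m+n n x))

  arc≡⇒side≡ : ∀ {t t′ s s′} → arc t s ≡ arc t′ s′ → side t s ≡ side t′ s′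
  arc≡⇒side≡ {s = ab} {ab} = toℕ-pair-injective
  arc≡⇒side≡ {s = ab} {bc} = toℕ-pair-injective
  arc≡⇒side≡ {s = bc} {ab} = toℕ-pair-injective
  arc≡⇒side≡ {s = bc} {bc} = toℕ-pair-injective
  arc≡⇒side≡ {s = ca} {ca} eq =
    cong₂ _,_ (Fin.toℕ-injective (+-cancelˡ-≡ n _ _ (cong proj₂ eq))) (Fin.toℕ-injective (cong proj₁ eq))
  arc≡⇒side≡ {t}          {s = ab} {ca} eq = contradiction (cong proj₂ eq) (unrolled-≢ (b t))
  arc≡⇒side≡ {t}          {s = bc} {ca} eq = contradiction (cong proj₂ eq) (unrolled-≢ (c t))
  arc≡⇒side≡ {t′ = t′} {s = ca} {ab} eq = contradiction (sym (cong proj₂ eq)) (unrolled-≢ (b t′))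
  arc≡⇒side≡ {t′ = t′} {s = ca} {bc} eq = contradiction (sym (cong proj₂ eq)) (unrolled-≢ (c t′))

  InnerFat : ℕ → Triangle n → Set
  InnerFat G t = Long G (arc t ab) × Long G (arc t bc)

  Fat : ℕ → Triangle n → Set
  Fat G t = InnerFat G t × Long G (arc t ca)

  fat? : ∀ G → Decidable (Fat G)
  fat? G t = (long? G (arc t ab) ×-dec long? G (arc t bc)) ×-dec long? G (arc t ca)

  arc∈shortArcs : ∀ G t s → ¬ Long G (arc t s) → arc t s ∈ shortArcs n G
  arc∈shortArcs G t s = ∈-shortArcs (arc t s) (arc-start<n t s) (arc-start<end t s)

  shortSide : ℕ → Triangle n → Side
  shortSide G t with long? G (arc t ab) | long? G (arc t bc)
  ... | no  _ | _     = ab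
  ... | yes _ | no  _ = bc
  ... | yes _ | yes _ = ca

  shortSide-short : ∀ G t → ¬ Fat G t → ¬ Long G (arc t (shortSide G t))
  shortSide-short G t ¬fat with long? G (arc t ab) | long? G (arc t bc)
  ... | no  ¬ab | _       = ¬ab
  ... | yes _   | no  ¬bc = ¬bc
  ... | yes ab↑ | yes bc↑ = λ ca↑ → ¬fat ((ab↑ , bc↑) , ca↑)

  Window : ℕ → ℕ → Triangle n → Set
  Window lo hi t = lo ≤ toℕ (a t) × toℕ (c t) < hi

  window? : ∀ lo hi → Decidable (Window lo hi)
  window? lo hi t = (lo ≤? toℕ (a t)) ×-dec (toℕ (c t) <? hi)

  NestedAB NestedBC Beyond : Triangle n → Triangle n → Set
  NestedAB t = Window (suc (toℕ (a t))) (toℕ (b t))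
  NestedBC t = Window (suc (toℕ (b t))) (toℕ (c t))
  Beyond t t′ = toℕ (c t) < toℕ (a t′)

  beyond? : ∀ t → Decidable (Beyond t)
  beyond? t t′ = toℕ (c t) <? toℕ (a t′)

  nestedAB? : ∀ t → Decidable (NestedAB t)
  nestedAB? t = window? (suc (toℕ (a t))) (toℕ (b t))

  nestedBC? : ∀ t → Decidable (NestedBC t)
  nestedBC? t = window? (suc (toℕ (b t))) (toℕ (c t))

  disjoint-trichotomy : ∀ {t t′} → Disjoint t t′ → toℕ (a t) < toℕ (a t′) →
    NestedAB t t′ ⊎ NestedBC t t′ ⊎ Beyond t t′
  disjoint-trichotomy {t} {t′} (disjoint t∥t′) a<a′ with Fin.<-cmp (a t′) (b t)
  ... | tri≈ _ a′≡b _ = contradiction (inj₁ (a t′ , inj₂ (inj₁ a′≡b) , inj₁ refl)) t∥t′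
  ... | tri< a′<b _ _ with Fin.<-cmp (c t′) (b t)
  ...   | tri< c′<b _ _ = inj₁ (a<a′ , c′<b)
  ...   | tri≈ _ c′≡b _ = contradiction (inj₁ (c t′ , inj₂ (inj₁ c′≡b) , inj₂ (inj₂ refl))) t∥t′
  ...   | tri> _ _ b<c′ = contradiction
    (inj₂ (a t , b t , a t′ , c t′ , inj₁ (refl , refl) , inj₂ (inj₁ (refl , refl)) ,
           inj₁ (a<a′ , a′<b , b<c′))) t∥t′
  disjoint-trichotomy {t} {t′} (disjoint t∥t′) a<a′ | tri> _ _ b<a′ with Fin.<-cmp (a t′) (c t)
  ...   | tri> _ _ c<a′ = inj₂ (inj₂ c<a′)
  ...   | tri≈ _ a′≡c _ = contradiction (inj₁ (a t′ , inj₂ (inj₂ a′≡c) , inj₁ refl)) t∥t′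
  ...   | tri< a′<c _ _ with Fin.<-cmp (c t′) (c t)
  ...     | tri< c′<c _ _ = inj₂ (inj₁ (b<a′ , c′<c))
  ...     | tri≈ _ c′≡c _ = contradiction (inj₁ (c t′ , inj₂ (inj₂ c′≡c) , inj₂ (inj₂ refl))) t∥t′
  ...     | tri> _ _ c<c′ = contradiction
    (inj₂ (b t , c t , a t′ , c t′ , inj₂ (inj₂ (refl , refl)) , inj₂ (inj₁ (refl , refl)) ,
           inj₁ (b<a′ , a′<c , c<c′))) t∥t′

  sharesLeft? : ∀ (v : Fin n) → Decidable (λ (t : Triangle n) → a t ≡ v)
  sharesLeft? v t = a t Fin.≟ v

  length-filter-sharesLeft≤1 : ∀ v S → AllPairs Disjoint S → length (filter (sharesLeft? v) S) ≤ 1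
  length-filter-sharesLeft≤1 v S disj =
    at-most-one (AllPairs.filter⁺ (sharesLeft? v) disj) (All.all-filter (sharesLeft? v) S)
    where
    at-most-one : ∀ {S} → AllPairs Disjoint S → All (λ t → a t ≡ v) S → length S ≤ 1
    at-most-one []                    _                    = z≤n
    at-most-one (_ ∷ [])              _                    = s≤s z≤n
    at-most-one ((disjoint t∥t′ ∷ _) ∷ _) (at≡v ∷ at′≡v ∷ _) =
      contradiction (inj₁ (v , inj₁ (sym at≡v) , inj₁ (sym at′≡v))) t∥t′

  Leftmost : Triangle n → List (Triangle n) → Set
  Leftmost t S = All (λ t′ → toℕ (a t) ≤ toℕ (a t′)) S

  leftmost : Triangle n → List (Triangle n) → Triangle n
  leftmost = argmin (toℕ ∘ a)

  leftmost-∈ : ∀ t ts → leftmost t ts ∈ t ∷ ts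
  leftmost-∈ t ts with argmin-sel (toℕ ∘ a) t ts
  ... | inj₁ ≡t   = here ≡t
  ... | inj₂ ∈ts  = there ∈ts

  leftmost-≤ : ∀ t ts → Leftmost (leftmost t ts) (t ∷ ts)
  leftmost-≤ t ts = f[argmin]≤f[⊤] {f = toℕ ∘ a} t ts ∷ f[argmin]≤f[xs] {f = toℕ ∘ a} t ts

  leftmost-cover : ∀ {t S} → t ∈ S → Leftmost t S → AllPairs Disjoint S →
    All (λ t′ → a t′ ≡ a t ⊎ NestedAB t t′ ⊎ NestedBC t t′ ⊎ Beyond t t′) S
  leftmost-cover {t} {S} t∈S t-leftmost disj = All.tabulate classify
    where
    same-or-disjoint : ∀ {t′} → t′ ∈ S → t ≡ t′ ⊎ Disjoint t t′
    same-or-disjoint t′∈S = AllPairs-lookup Disjoint-sym disj t∈S t′∈S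
    classify : ∀ {t′} → t′ ∈ S → a t′ ≡ a t ⊎ NestedAB t t′ ⊎ NestedBC t t′ ⊎ Beyond t t′
    classify {t′} t′∈S with m≤n⇒m<n∨m≡n (All.lookup t-leftmost t′∈S) | same-or-disjoint t′∈S
    ... | inj₂ a≡a′ | _         = inj₁ (Fin.toℕ-injective (sym a≡a′))
    ... | inj₁ a<a′ | inj₁ refl = contradiction refl (<⇒≢ a<a′)
    ... | inj₁ a<a′ | inj₂ t∥t′ = inj₂ (disjoint-trichotomy t∥t′ a<a′)

  length-≤-split : ∀ {t S} → t ∈ S → Leftmost t S → AllPairs Disjoint S →
    length S ≤ suc (length (filter (nestedAB? t) S) + (length (filter (nestedBC? t) S) + length (filter (beyond? t) S)))
  length-≤-split {t} {S} t∈S t-leftmost disj = begin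
    length S
      ≤⟨ length-≤-cover (sharesLeft? (a t)) inner? (leftmost-cover t∈S t-leftmost disj) ⟩
    length (filter (sharesLeft? (a t)) S) + length (filter inner? S)
      ≤⟨ +-mono-≤ (length-filter-sharesLeft≤1 (a t) S disj)
                  (≤-trans (length-filter-∪ (nestedAB? t) (nestedBC? t ∪? beyond? t) S)
                           (+-monoʳ-≤ _ (length-filter-∪ (nestedBC? t) (beyond? t) S))) ⟩
    suc (length (filter (nestedAB? t) S) + (length (filter (nestedBC? t) S) + length (filter (beyond? t) S))) ∎
    where
    inner? : Decidable (NestedAB t ∪ (NestedBC t ∪ Beyond t))
    inner? = nestedAB? t ∪? (nestedBC? t ∪? beyond? t)

  Packs : ℕ → List (Triangle n) → Set
  Packs G S = ∀ {lo hi} → AllPairs Disjoint S → All (InnerFat G) S → All (Window lo hi) S →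
    lo + G ≤ hi → lo + length S * (G + 3) + G ≤ hi

  -- The other members lie inside the arcs ab and bc of the leftmost triangle t or
  -- between c t and h; each of these three families is packed separately.
  leftmost-bound : ∀ G t₀ ts {lo hi h} → (∀ S′ → length S′ < length (t₀ ∷ ts) → Packs G S′) →
    AllPairs Disjoint (t₀ ∷ ts) → All (InnerFat G) (t₀ ∷ ts) → All (Window lo hi) (t₀ ∷ ts) →
    hi ≤ h → suc (toℕ (c (leftmost t₀ ts))) + G ≤ h →
    toℕ (a (leftmost t₀ ts)) + (length (t₀ ∷ ts) * (G + 3) + 2 * G) ≤ h
  leftmost-bound G t₀ ts {lo} {hi} {h} packs disj fat win hi≤h c+G≤h = begin
    A + (length S * (G + 3) + 2 * G)
      ≤⟨ +-monoʳ-≤ A (+-monoˡ-≤ (2 * G) (*-monoˡ-≤ (G + 3) length-S≤)) ⟩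
    A + (suc (length inAB + (length inBC + length beyond)) * (G + 3) + 2 * G)
      ≤⟨ gaps-add-up {s₁ = length inAB} {length inBC} {length beyond} a→b b→c c→h ⟩
    h ∎
    where
    S : List (Triangle n)
    S = t₀ ∷ ts
    t : Triangle n
    t = leftmost t₀ ts
    t∈S : t ∈ S
    t∈S = leftmost-∈ t₀ ts
    A : ℕ
    A = toℕ (a t)
    inAB inBC beyond : List (Triangle n)
    inAB   = filter (nestedAB? t) S
    inBC   = filter (nestedBC? t) S
    beyond = filter (beyond? t) S
    length-S≤ : length S ≤ suc (length inAB + (length inBC + length beyond))
    length-S≤ = length-≤-split t∈S (leftmost-≤ t₀ ts) disj
    t-fat : InnerFat G t
    t-fat = All.lookup fat t∈S
    packs-filter : ∀ {P : Triangle n → Set} (P? : Decidable P) {lo′ hi′} → ¬ P t →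
      All (Window lo′ hi′) (filter P? S) → lo′ + G ≤ hi′ → lo′ + length (filter P? S) * (G + 3) + G ≤ hi′
    packs-filter P? ¬Pt = packs (filter P? S) (filter-notAll P? S (lose t∈S ¬Pt))
      (AllPairs.filter⁺ P? disj) (All.filter⁺ P? fat)
    a→b : suc A + length inAB * (G + 3) + G ≤ toℕ (b t)
    a→b = packs-filter (nestedAB? t) (λ (a<a , _) → <-irrefl refl a<a)
      (All.all-filter (nestedAB? t) S) (proj₁ t-fat)
    b→c : suc (toℕ (b t)) + length inBC * (G + 3) + G ≤ toℕ (c t)
    b→c = packs-filter (nestedBC? t) (λ (b<a , _) → <-asym b<a (a<b t))
      (All.all-filter (nestedBC? t) S) (proj₂ t-fat)
    beyond-window : All (Window (suc (toℕ (c t))) h) beyond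
    beyond-window = All.zipWith (λ (c<a′ , _ , c′<hi) → c<a′ , <-≤-trans c′<hi hi≤h)
      (All.all-filter (beyond? t) S , All.filter⁺ (beyond? t) win)
    c→h : suc (toℕ (c t)) + length beyond * (G + 3) + G ≤ h
    c→h = packs-filter (beyond? t) (λ c<a → <-asym c<a (<-trans (a<b t) (b<c t))) beyond-window c+G≤h

  packing : ∀ G S → Packs G S
  packing G S = packing-acc S (<-wellFounded (length S))
    where
    packing-acc : ∀ S → Acc _<_ (length S) → Packs G S
    packing-acc [] _ {lo} {hi} _ _ _ lo+G≤hi = subst (λ x → x + G ≤ hi) (sym (+-identityʳ lo)) lo+G≤hi
    packing-acc (t₀ ∷ ts) (acc shorter) {lo} {hi} disj fat win _ = +-cancelʳ-≤ G _ _ (begin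
      lo + L * (G + 3) + G + G   ≡⟨ regroup lo (L * (G + 3)) G ⟩
      lo + (L * (G + 3) + 2 * G) ≤⟨ +-monoˡ-≤ _ (proj₁ (All.lookup win t∈S)) ⟩
      toℕ (a (leftmost t₀ ts)) + (L * (G + 3) + 2 * G)
        ≤⟨ leftmost-bound G t₀ ts (λ S′ S′<S → packing-acc S′ (shorter S′<S)) disj fat win
             (m≤m+n hi G) (+-monoˡ-≤ G (proj₂ (All.lookup win t∈S))) ⟩
      hi + G                     ∎)
      where
      L : ℕ
      L = length (t₀ ∷ ts)
      t∈S : leftmost t₀ ts ∈ t₀ ∷ ts
      t∈S = leftmost-∈ t₀ ts
      regroup : ∀ lo x G → lo + x + G + G ≡ lo + (x + 2 * G)
      regroup = solve-∀

  cyclic-packing : ∀ G (S : List (Triangle n)) → AllPairs Disjoint S → All (Fat G) S → 2 * G ≤ n →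
    length S * (G + 3) + 2 * G ≤ n
  cyclic-packing G []        _    _   2G≤n = 2G≤n
  cyclic-packing G (t₀ ∷ ts) disj fat _    = +-cancelˡ-≤ A _ _ (begin
    A + (length (t₀ ∷ ts) * (G + 3) + 2 * G)
      ≤⟨ leftmost-bound G t₀ ts (λ S′ _ → packing G S′) disj (All.map proj₁ fat)
           (All.tabulate (λ {t} _ → z≤n , Fin.toℕ<n (c t))) (m≤m+n n A)
           (proj₂ (All.lookup fat (leftmost-∈ t₀ ts))) ⟩
    n + A ≡⟨ +-comm n A ⟩
    A + n ∎)
    where
    A : ℕ
    A = toℕ (a (leftmost t₀ ts))

-- A triangle decomposition of the complete convex geometric graph

sides : List Side
sides = ab ∷ bc ∷ ca ∷ []

∈-sides : ∀ s → s ∈ sides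
∈-sides ab = here refl
∈-sides bc = there (here refl)
∈-sides ca = there (there (here refl))

module _ {n m : ℕ} (T : Fin m → Triangle n) (D : IsTriangleDecomposition T) where

  edgeOf-unique : ∀ {i j r r′} → toℕ i < toℕ j → EdgeOf i j (T r) → EdgeOf i j (T r′) → r ≡ r′
  edgeOf-unique i<j ij∈r ij∈r′ = let _ , _ , unique = D _ _ i<j in trans (unique _ ij∈r) (sym (unique _ ij∈r′))

  side-injective : ∀ {r r′ s s′} → side (T r) s ≡ side (T r′) s′ → r ≡ r′
  side-injective {r} {r′} {s} {s′} eq = edgeOf-unique (side-< (T r) s) (side-edgeOf (T r) s)
    (subst (λ e → EdgeOf (proj₁ e) (proj₂ e) (T r′)) (sym eq) (side-edgeOf (T r′) s′))

  chords : List (Fin n × Fin n)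
  chords = map (λ (r , s) → side (T r) s) (cartesianProduct (allFin m) sides)

  chord-∈ : ∀ {i j} → toℕ i < toℕ j → (i , j) ∈ chords
  chord-∈ {i} {j} i<j =
    let r , ij∈r , _ = D i j i<j
        s , side≡ij  = edgeOf⇒side ij∈r
    in subst (_∈ chords) side≡ij (∈-map⁺ _ (∈-cartesianProduct⁺ (∈-allFin r) (∈-sides s)))

  diagonal : List (Fin n × Fin n)
  diagonal = map (λ i → i , i) (allFin n)

  ordered-pairs-⊆ : cartesianProduct (allFin n) (allFin n) ⊆ diagonal ++ chords ++ map swap chords
  ordered-pairs-⊆ {i , j} _ with Fin.<-cmp i j
  ... | tri< i<j _ _  = ∈-++⁺ʳ diagonal (∈-++⁺ˡ (chord-∈ i<j))
  ... | tri≈ _ refl _ = ∈-++⁺ˡ (∈-map⁺ (λ i → i , i) (∈-allFin i))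
  ... | tri> _ _ j<i  = ∈-++⁺ʳ diagonal (∈-++⁺ʳ chords (∈-map⁺ swap (chord-∈ j<i)))

  n²≤n+6m : n * n ≤ n + 6 * m
  n²≤n+6m = begin
    n * n
      ≡⟨ trans (length-cartesianProduct (allFin n) (allFin n)) (cong₂ _*_ (length-allFin n) (length-allFin n)) ⟨
    length (cartesianProduct (allFin n) (allFin n))
      ≤⟨ Unique-⊆⇒length≤ (Unique.cartesianProduct⁺ (Unique.allFin⁺ n) (Unique.allFin⁺ n)) ordered-pairs-⊆ ⟩
    length (diagonal ++ chords ++ map swap chords)
      ≡⟨ trans (length-++ diagonal) (cong (length diagonal +_) (length-++ chords)) ⟩
    length diagonal + (length chords + length (map swap chords))
      ≡⟨ cong₂ _+_ (trans (length-map _ (allFin n)) (length-allFin n))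
                   (cong₂ _+_ length-chords (trans (length-map swap chords) length-chords)) ⟩
    n + (m * 3 + m * 3)
      ≡⟨ cong (n +_) (double m) ⟩
    n + 6 * m ∎
    where
    length-chords : length chords ≡ m * 3
    length-chords = trans (length-map _ (cartesianProduct (allFin m) sides))
      (trans (length-cartesianProduct (allFin m) sides) (cong (_* 3) (length-allFin m)))
    double : ∀ m → m * 3 + m * 3 ≡ 6 * m
    double = solve-∀

  fatOnes thinOnes : ℕ → List (Fin m)
  fatOnes  G = filter (fat? G ∘ T) (allFin m)
  thinOnes G = filter (∁? (fat? G ∘ T)) (allFin m)

  m≤fat+thin : ∀ G → m ≤ length (fatOnes G) + length (thinOnes G)
  m≤fat+thin G = subst (_≤ length (fatOnes G) + length (thinOnes G)) (length-allFin m)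
    (length-≤-filter+∁ (fat? G ∘ T) (allFin m))

  -- A thin triangle is coded by a short arc, which determines the triangle.
  shortArc : ℕ → Fin m → ℕ × ℕ
  shortArc G r = arc (T r) (shortSide G (T r))

  length-thinOnes≤ : ∀ G → length (thinOnes G) ≤ n * G
  length-thinOnes≤ G = begin
    length (thinOnes G)                  ≡⟨ length-map (shortArc G) (thinOnes G) ⟨
    length (map (shortArc G) (thinOnes G)) ≤⟨ Unique-⊆⇒length≤ codes-unique codes-short ⟩
    length (shortArcs n G)               ≡⟨ length-shortArcs n G ⟩
    n * G                                ∎
    where
    codes-unique : Unique (map (shortArc G) (thinOnes G))
    codes-unique = Unique.map⁺ (side-injective ∘ arc≡⇒side≡)
      (Unique.filter⁺ (∁? (fat? G ∘ T)) (Unique.allFin⁺ m))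
    codes-short : map (shortArc G) (thinOnes G) ⊆ shortArcs n G
    codes-short code∈ with ∈-map⁻ (shortArc G) code∈
    ... | r , r∈thin , refl =
      arc∈shortArcs G (T r) _
        (shortSide-short G (T r) (proj₂ (∈-filter⁻ (∁? (fat? G ∘ T)) {xs = allFin m} r∈thin)))

  module _ (G : ℕ) {k} (col : Fin m → Fin k) (proper : IsPColoring T col) (2G≤n : 2 * G ≤ n) where

    colourClass : ℕ → List (Fin m)
    colourClass c = filter (λ r → toℕ (col r) ≟ c) (fatOnes G)

    length-colourClass : ∀ c → length (colourClass c) * (G + 3) ≤ n ∸ 2 * G
    length-colourClass c = m+n≤o⇒m≤o∸n _
      (subst (λ L → L * (G + 3) + 2 * G ≤ n) (length-map T (colourClass c))
        (cyclic-packing G (map T (colourClass c)) class-disjoint class-fat 2G≤n))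
      where
      same-colour-disjoint : AllPairs (λ r r′ → toℕ (col r) ≡ toℕ (col r′) → Disjoint (T r) (T r′)) (allFin m)
      same-colour-disjoint = AllPairs.map
        (λ r≢r′ same → disjoint λ I → proper _ _ r≢r′ I (Fin.toℕ-injective same)) (Unique.allFin⁺ m)
      class-disjoint : AllPairs Disjoint (map T (colourClass c))
      class-disjoint = AllPairs.map⁺ (AllPairs-fibre (toℕ ∘ col)
        (AllPairs.filter⁺ _ (AllPairs.filter⁺ (fat? G ∘ T) same-colour-disjoint))
        (All.all-filter (λ r → toℕ (col r) ≟ c) (fatOnes G)))
      class-fat : All (Fat G) (map T (colourClass c))
      class-fat = All.map⁺ (All.filter⁺ _ (All.all-filter (fat? G ∘ T) (allFin m)))

    length-fatOnes : length (fatOnes G) * (G + 3) ≤ k * (n ∸ 2 * G)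
    length-fatOnes = length*≤-by-colour (toℕ ∘ col) (G + 3) (n ∸ 2 * G) k (fatOnes G)
      (All.tabulate (λ {r} _ → Fin.toℕ<n (col r))) (λ c _ → length-colourClass c)

-- Arithmetic

2[n/11]≤n : ∀ n → 2 * (n / 11) ≤ n
2[n/11]≤n n = begin
  2 * (n / 11)  ≤⟨ *-monoˡ-≤ (n / 11) (m≤m+n 2 9) ⟩
  11 * (n / 11) ≡⟨ *-comm 11 (n / 11) ⟩
  n / 11 * 11   ≤⟨ m/n*n≤m n 11 ⟩
  n             ∎

small≤big : ∀ G ρ → 1 ≤ G → ρ ≤ 10 → ρ * G + 6 * (ρ * ρ) + 357 ≤ G * G + 8092 * G + 1071 * ρ
small≤big G ρ 1≤G ρ≤10 = begin
  ρ * G + 6 * (ρ * ρ) + 357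
    ≤⟨ +-mono-≤ (+-mono-≤ (*-monoˡ-≤ G ρ≤10) (*-monoʳ-≤ 6 (*-monoˡ-≤ ρ ρ≤10))) (*-monoʳ-≤ 357 1≤G) ⟩
  10 * G + 6 * (10 * ρ) + 357 * G
    ≡⟨ collect G ρ ⟩
  367 * G + 60 * ρ
    ≤⟨ +-mono-≤ (*-monoˡ-≤ G (m≤m+n 367 7725)) (*-monoˡ-≤ ρ (m≤m+n 60 1011)) ⟩
  8092 * G + 1071 * ρ
    ≤⟨ m≤n+m _ (G * G) ⟩
  G * G + (8092 * G + 1071 * ρ)
    ≡⟨ +-assoc (G * G) _ _ ⟨
  G * G + 8092 * G + 1071 * ρ ∎
  where
  collect : ∀ G ρ → 10 * G + 6 * (10 * ρ) + 357 * G ≡ 367 * G + 60 * ρ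
  collect = solve-∀

-- The two sides differ by G² + 8092 G + 1071 ρ − (ρ G + 6 ρ² + 357), which is
-- positive for G ≥ 1 and ρ ≤ 10.
key-inequality : ∀ G ρ → 1 ≤ G → ρ < 11 →
  6 * (9 * G + ρ) * (ρ + G * 11) + 119 * (G + 3) * (1 + 6 * G) ≤ 119 * (G + 3) * (ρ + G * 11) + 714 * (9 * G + ρ)
key-inequality G ρ 1≤G ρ<11 = +-cancelʳ-≤ big _ _ (begin
  6 * (9 * G + ρ) * (ρ + G * 11) + 119 * (G + 3) * (1 + 6 * G) + big
    ≡⟨ identity G ρ ⟩
  119 * (G + 3) * (ρ + G * 11) + 714 * (9 * G + ρ) + small
    ≤⟨ +-monoʳ-≤ (119 * (G + 3) * (ρ + G * 11) + 714 * (9 * G + ρ)) (small≤big G ρ 1≤G (s≤s⁻¹ ρ<11)) ⟩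
  119 * (G + 3) * (ρ + G * 11) + 714 * (9 * G + ρ) + big ∎)
  where
  big small : ℕ
  big   = G * G + 8092 * G + 1071 * ρ
  small = ρ * G + 6 * (ρ * ρ) + 357
  identity : ∀ G ρ →
    6 * (9 * G + ρ) * (ρ + G * 11) + 119 * (G + 3) * (1 + 6 * G) + (G * G + 8092 * G + 1071 * ρ)
    ≡ 119 * (G + 3) * (ρ + G * 11) + 714 * (9 * G + ρ) + (ρ * G + 6 * (ρ * ρ) + 357)
  identity = solve-∀

quadratic-bound : ∀ {n m F k G ρ} → n ≡ ρ + G * 11 → ρ < 11 →
  n * n ≤ n + 6 * m → m ≤ F + n * G → F * (G + 3) ≤ k * (n ∸ 2 * G) → n * n ≤ 119 * (k + n)
quadratic-bound {k = k} {zero} {ρ} refl ρ<11 _ _ _ = begin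
  n * n       ≤⟨ *-monoˡ-≤ n n≤10 ⟩
  10 * n      ≤⟨ *-monoˡ-≤ n (m≤m+n 10 109) ⟩
  119 * n     ≤⟨ *-monoʳ-≤ 119 (m≤n+m n k) ⟩
  119 * (k + n) ∎
  where
  n : ℕ
  n = ρ + 0
  n≤10 : n ≤ 10
  n≤10 = subst (_≤ 10) (sym (+-identityʳ ρ)) (s≤s⁻¹ ρ<11)
-- With W = n ∸ 2G, scale the goal by 6 W and the count of pairs by 119 (G + 3).
quadratic-bound {F = F} {k} {G@(suc _)} {ρ} refl ρ<11 pairs m≤F+nG F≤ =
  *-cancelˡ-≤ (6 * W) (+-cancelʳ-≤ (119 * (G + 3) * (n * n)) _ _ (begin
    6 * W * (n * n) + 119 * (G + 3) * (n * n)
      ≤⟨ +-monoʳ-≤ (6 * W * (n * n)) (*-monoʳ-≤ (119 * (G + 3)) n²≤) ⟩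
    6 * W * (n * n) + 119 * (G + 3) * (n + 6 * (F + n * G))
      ≡⟨ expand n W G F ⟩
    n * (6 * W * n + 119 * (G + 3) * (1 + 6 * G)) + 714 * (F * (G + 3))
      ≤⟨ +-mono-≤ (*-monoʳ-≤ n (key-inequality G ρ (s≤s z≤n) ρ<11)) (*-monoʳ-≤ 714 F≤kW) ⟩
    n * (119 * (G + 3) * n + 714 * W) + 714 * (k * W)
      ≡⟨ collect n W G k ⟩
    6 * W * (119 * (k + n)) + 119 * (G + 3) * (n * n) ∎))
  where
  n W : ℕ
  n = ρ + G * 11
  W = 9 * G + ρ
  n²≤ : n * n ≤ n + 6 * (F + n * G)
  n²≤ = ≤-trans pairs (+-monoʳ-≤ n (*-monoʳ-≤ 6 m≤F+nG))
  n∸2G≡W : n ∸ 2 * G ≡ W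
  n∸2G≡W = trans (cong (_∸ 2 * G) (split G ρ)) (m+n∸n≡m W (2 * G))
    where
    split : ∀ G ρ → ρ + G * 11 ≡ 9 * G + ρ + 2 * G
    split = solve-∀
  F≤kW : F * (G + 3) ≤ k * W
  F≤kW = subst (λ x → F * (G + 3) ≤ k * x) n∸2G≡W F≤
  expand : ∀ n W G F → 6 * W * (n * n) + 119 * (G + 3) * (n + 6 * (F + n * G))
    ≡ n * (6 * W * n + 119 * (G + 3) * (1 + 6 * G)) + 714 * (F * (G + 3))
  expand = solve-∀
  collect : ∀ n W G k → n * (119 * (G + 3) * n + 714 * W) + 714 * (k * W)
    ≡ 6 * W * (119 * (k + n)) + 119 * (G + 3) * (n * n)
  collect = solve-∀

theorem3p3 : Σ ℕ (λ C → ∀ (n m : ℕ) (T : Fin m → Triangle n) →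
    IsTriangleDecomposition T →
    ∀ (k : ℕ) (col : Fin m → Fin k) → IsPColoring T col →
    n * n ≤ 119 * (k + C * n))
theorem3p3 = 1 , λ n m T D k col proper →
  let G = n / 11 in
  subst (λ x → n * n ≤ 119 * (k + x)) (sym (*-identityˡ n))
    (quadratic-bound {k = k} (m≡m%n+[m/n]*n n 11) (m%n<n n 11)
      (n²≤n+6m T D)
      (≤-trans (m≤fat+thin T D G) (+-monoʳ-≤ _ (length-thinOnes≤ T D G)))
      (length-fatOnes T D G col proper (2[n/11]≤n n)))
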